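{- Let $s$ be a Sturmian sequence. Then $\phi(s)$ contains exactly $n+3$ distinct factors of length $n$, for every $n\ge1$.
   Context: A Sturmian sequence is an infinite binary sequence having exactly $n+1$ distinct factors (contiguous subwords) of length $n$ for every $n\ge1$. $\phi$ maps binary sequences to words over $\{\mathsf{l}_\mathsf{u},\mathsf{u}_\mathsf{l},\mathsf{r}_\mathsf{u},\mathsf{u}_\mathsf{r}\}$ letterwise via $\phi(0)=\mathsf{l}_\mathsf{u}\mathsf{u}_\mathsf{l}$ and $\phi(1)=\mathsf{r}_\mathsf{u}\mathsf{u}_\mathsf{r}$. -}

module Defs where

open import Data.Nat using (ℕ; zero; suc; _+_; _≤_)
import Data.Nat
import Data.Bool
open import Data.Bool using (Bool; true; false)
open import Data.Fin using (Fin; toℕ)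
open import Data.Vec using (Vec; lookup)
open import Data.List using (List; length)
open import Data.List.Relation.Unary.All using (All)
open import Data.List.Relation.Unary.Unique.Propositional using (Unique)
open import Data.List.Membership.Propositional using (_∈_)
open import Data.Product using (Σ; ∃; _×_)
open import Relation.Binary.PropositionalEquality using (_≡_)

Seq : Set → Set
Seq A = ℕ → A

IsFactor : {A : Set} → Seq A → {n : ℕ} → Vec A n → Set
IsFactor s {n} w = ∃ λ i → (j : Fin n) → lookup w j ≡ s (i + toℕ j)

HasExactlyFactors : {A : Set} → Seq A → (n k : ℕ) → Set
HasExactlyFactors {A} s n k =
  Σ (List (Vec A n)) λ ws →
    length ws ≡ k × Unique ws × All (IsFactor s) ws
    × ((w : Vec A n) → IsFactor s w → w ∈ ws)

-- Binary sequences: alphabet {0,1} encoded as Bool (false = 0, true = 1).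
Sturmian : Seq Bool → Set
Sturmian s = (n : ℕ) → 1 ≤ n → HasExactlyFactors s n (suc n)

data Letter : Set where
  lᵤ uₗ rᵤ uᵣ : Letter

-- φ(0) = l_u u_l ,  φ(1) = r_u u_r, applied letterwise.
φ : Seq Bool → Seq Letter
φ s zero = Data.Bool.if s 0 then rᵤ else lᵤ
φ s (suc zero) = Data.Bool.if s 0 then uᵣ else uₗ
φ s (suc (suc k)) = φ (λ i → s (suc i)) k

{-# OPTIONS --safe #-}
module Submission where

-- A factor of φ(s) of length n starting at the even position 2i is the letterwise image
-- of the factor of s of length ⌈n/2⌉ at i; one starting at 2i+1 is the image of the factor
-- of length ⌊n/2⌋+1 at i. Both encodings are injective, and their images are disjoint
-- because the first letter (l_u, r_u versus u_l, u_r) reveals the parity of the position.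
-- The count is therefore (⌈n/2⌉+1) + (⌊n/2⌋+2) = n+3.

open import Defs
open import Data.Nat using (ℕ; zero; suc; _≤_; _<_; _+_; z≤n; s≤s; z<s; ⌊_/2⌋; ⌈_/2⌉; parity)
open import Data.Nat.Properties using (+-suc; +-assoc; +-monoʳ-<; ⌊n/2⌋-mono; ⌈n/2⌉-mono; ⌊n/2⌋+⌈n/2⌉≡n; n≡⌊n+n/2⌋)
open import Data.Nat.Tactic.RingSolver using (solve-∀)
open import Data.Parity.Base using (Parity; 0ℙ; 1ℙ)
open import Data.Bool using (Bool; true; false; if_then_else_)
open import Data.Fin using (Fin; toℕ; fromℕ<) renaming (zero to fzero)
open import Data.Fin.Properties using (toℕ-fromℕ<; toℕ-injective; toℕ<n)
open import Data.Vec using (Vec; lookup; tabulate)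
open import Data.Vec.Properties using (lookup∘tabulate; tabulate-cong)
open import Data.Vec.Relation.Binary.Pointwise.Extensional using (ext; Pointwise-≡⇒≡)
open import Data.List using (List; length; map; _++_)
open import Data.List.Properties using (length-map; length-++)
open import Data.List.Relation.Unary.All as All using (All)
import Data.List.Relation.Unary.All.Properties as All
open import Data.List.Relation.Unary.Unique.Propositional using (Unique)
import Data.List.Relation.Unary.Unique.Propositional.Properties as Unique
open import Data.List.Membership.Propositional using (_∈_)
open import Data.List.Membership.Propositional.Properties using (∈-map⁺; ∈-++⁺ˡ; ∈-++⁺ʳ)
open import Data.Product using (Σ; ∃; _×_; _,_)
open import Data.Sum using (_⊎_; inj₁; inj₂)
open import Function.Bundles using (_⇔_; mk⇔; Equivalence)
open import Function.Definitions using (Injective)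
open import Function.Properties.Equivalence using () renaming (sym to ⇔-sym)
open import Relation.Nullary using (¬_)
open import Relation.Binary.PropositionalEquality

private
  variable
    A B : Set
    c k l m n : ℕ

Enumerates : (A → Set) → List A → Set
Enumerates P ws = Unique ws × All P ws × (∀ w → P w → w ∈ ws)

-- HasExactlyFactors s n k is definitionally HasExactly (IsFactor s {n}) k.
HasExactly : (A → Set) → ℕ → Set
HasExactly {A} P k = Σ (List A) λ ws → length ws ≡ k × Enumerates P ws

Image : (A → B) → (A → Set) → B → Set
Image f P y = ∃ λ x → P x × f x ≡ y

hasExactly-resp-⇔ : {P Q : A → Set} → (∀ x → P x ⇔ Q x) → HasExactly P k → HasExactly Q k
hasExactly-resp-⇔ P⇔Q (ws , len , uniq , all , complete) =
  ws , len , uniq , All.map (λ {x} → Equivalence.to (P⇔Q x)) all ,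
  λ x q → complete x (Equivalence.from (P⇔Q x) q)

hasExactly-image : {P : A → Set} {f : A → B} →
                   Injective _≡_ _≡_ f → HasExactly P k → HasExactly (Image f P) k
hasExactly-image {f = f} f-inj (ws , len , uniq , all , complete) =
  map f ws , trans (length-map f ws) len , Unique.map⁺ f-inj uniq ,
  All.map⁺ (All.map (λ {x} p → x , p , refl) all) ,
  λ { _ (x , p , refl) → ∈-map⁺ f (complete x p) }

hasExactly-⊎ : {P Q : A → Set} → (∀ {x} → P x → ¬ Q x) →
               HasExactly P k → HasExactly Q l → HasExactly (λ x → P x ⊎ Q x) (k + l)
hasExactly-⊎ disjoint (ws , len , uniq , all , complete) (vs , len′ , uniq′ , all′ , complete′) =
  ws ++ vs , trans (length-++ ws) (cong₂ _+_ len len′) ,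
  Unique.++⁺ uniq uniq′ (λ (x∈ws , x∈vs) → disjoint (All.lookup all x∈ws) (All.lookup all′ x∈vs)) ,
  All.++⁺ (All.map inj₁ all) (All.map inj₂ all′) ,
  λ { x (inj₁ p) → ∈-++⁺ˡ (complete x p) ; x (inj₂ q) → ∈-++⁺ʳ ws (complete′ x q) }

factorAt : Seq A → ℕ → (n : ℕ) → Vec A n
factorAt s i n = tabulate λ j → s (i + toℕ j)

isFactor⇔factorAt : (s : Seq A) (w : Vec A n) → IsFactor s w ⇔ (∃ λ i → factorAt s i n ≡ w)
isFactor⇔factorAt s w = mk⇔
  (λ (i , w≡s) → i , Pointwise-≡⇒≡ (ext λ j → trans (lookup∘tabulate _ j) (sym (w≡s j))))
  (λ { (i , refl) → i , lookup∘tabulate _ })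

reindex : (Fin n → A → B) → (Fin n → Fin m) → Vec A m → Vec B n
reindex e g u = tabulate λ j → e j (lookup u (g j))

reindex-injective : {e : Fin n → A → B} {g : Fin n → Fin m} →
                    (∀ j → Injective _≡_ _≡_ (e j)) → (∀ k → ∃ λ j → g j ≡ k) →
                    Injective _≡_ _≡_ (reindex e g)
reindex-injective {e = e} {g} e-inj g-onto {u} {v} eq = Pointwise-≡⇒≡ (ext agree)
  where
  agree : ∀ k → lookup u k ≡ lookup v k
  agree k with g-onto k
  ... | j , refl = e-inj j (begin
    e j (lookup u (g j))      ≡⟨ lookup∘tabulate _ j ⟨
    lookup (reindex e g u) j  ≡⟨ cong (λ w → lookup w j) eq ⟩
    lookup (reindex e g v) j  ≡⟨ lookup∘tabulate _ j ⟩
    e j (lookup v (g j))      ∎)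
    where open ≡-Reasoning

m<⌈n/2⌉⇒m+m<n : m < ⌈ n /2⌉ → m + m < n
m<⌈n/2⌉⇒m+m<n {zero}  {suc n}       _        = z<s
m<⌈n/2⌉⇒m+m<n {suc m} {suc (suc n)} (s≤s m<) =
  s≤s (s≤s (subst (_≤ n) (sym (+-suc m m)) (m<⌈n/2⌉⇒m+m<n m<)))
m<⌈n/2⌉⇒m+m<n {suc m} {suc zero}    (s≤s ())

⌊c+j/2⌋-onto : c ≤ 1 → 1 ≤ n → k < ⌈ c + n /2⌉ → ∃ λ j → j < n × ⌊ c + j /2⌋ ≡ k
⌊c+j/2⌋-onto {k = k} z≤n _ k< =
  k + k , m<⌈n/2⌉⇒m+m<n k< , sym (n≡⌊n+n/2⌋ k)
⌊c+j/2⌋-onto {k = zero} (s≤s z≤n) 1≤n _ =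
  zero , 1≤n , refl
⌊c+j/2⌋-onto {n = suc n} {k = suc k} (s≤s z≤n) _ (s≤s k<) =
  suc (k + k) , s≤s (m<⌈n/2⌉⇒m+m<n k<) , cong suc (sym (n≡⌊n+n/2⌋ k))

suc-i+suc-i : ∀ i x → suc i + suc i + x ≡ suc (suc (i + i + x))
suc-i+suc-i i x = cong (λ y → suc (y + x)) (+-suc i i)

even-or-odd : ∀ p → (∃ λ i → p ≡ i + i + 0) ⊎ (∃ λ i → p ≡ i + i + 1)
even-or-odd zero             = inj₁ (0 , refl)
even-or-odd (suc zero)       = inj₂ (0 , refl)
even-or-odd (suc (suc p)) with even-or-odd p
... | inj₁ (i , refl) = inj₁ (suc i , sym (suc-i+suc-i i 0))
... | inj₂ (i , refl) = inj₂ (suc i , sym (suc-i+suc-i i 1))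

blockLetter : Parity → Bool → Letter
blockLetter 0ℙ b = if b then rᵤ else lᵤ
blockLetter 1ℙ b = if b then uᵣ else uₗ

blockLetter-injective : ∀ p → Injective _≡_ _≡_ (blockLetter p)
blockLetter-injective 0ℙ {false} {false} _ = refl
blockLetter-injective 0ℙ {true}  {true}  _ = refl
blockLetter-injective 1ℙ {false} {false} _ = refl
blockLetter-injective 1ℙ {true}  {true}  _ = refl
blockLetter-injective 0ℙ {false} {true}  ()
blockLetter-injective 0ℙ {true}  {false} ()
blockLetter-injective 1ℙ {false} {true}  ()
blockLetter-injective 1ℙ {true}  {false} ()

blockLetter-0ℙ≢1ℙ : ∀ b b′ → blockLetter 0ℙ b ≢ blockLetter 1ℙ b′
blockLetter-0ℙ≢1ℙ false false ()
blockLetter-0ℙ≢1ℙ false true  ()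
blockLetter-0ℙ≢1ℙ true  false ()
blockLetter-0ℙ≢1ℙ true  true  ()

φ-blockLetter : ∀ s q → φ s q ≡ blockLetter (parity q) (s ⌊ q /2⌋)
φ-blockLetter s zero          = refl
φ-blockLetter s (suc zero)    = refl
φ-blockLetter s (suc (suc q)) = φ-blockLetter (λ i → s (suc i)) q

φ-shift : ∀ s i q → φ s (i + i + q) ≡ φ (λ k → s (i + k)) q
φ-shift s zero    q = refl
φ-shift s (suc i) q = trans (cong (φ s) (suc-i+suc-i i q)) (φ-shift (λ k → s (suc k)) i q)

blockIndex : (c : ℕ) → Fin n → Fin ⌈ c + n /2⌉
blockIndex c j = fromℕ< (⌊n/2⌋-mono (s≤s (+-monoʳ-< c (toℕ<n j))))

blockIndex-onto : c ≤ 1 → 1 ≤ n → (k : Fin ⌈ c + n /2⌉) → ∃ λ j → blockIndex c j ≡ k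
blockIndex-onto {c} c≤1 1≤n k with ⌊c+j/2⌋-onto c≤1 1≤n (toℕ<n k)
... | j , j<n , ⌊c+j/2⌋≡k = fromℕ< j<n , toℕ-injective (begin
  toℕ (blockIndex c (fromℕ< j<n))  ≡⟨ toℕ-fromℕ< _ ⟩
  ⌊ c + toℕ (fromℕ< j<n) /2⌋       ≡⟨ cong (λ x → ⌊ c + x /2⌋) (toℕ-fromℕ< j<n) ⟩
  ⌊ c + j /2⌋                      ≡⟨ ⌊c+j/2⌋≡k ⟩
  toℕ k                            ∎)
  where open ≡-Reasoning

-- The factor of length n starting at offset c of the concatenated blocks φ(u).
spread : (c n : ℕ) → Vec Bool ⌈ c + n /2⌉ → Vec Letter n
spread c n = reindex (λ j → blockLetter (parity (c + toℕ j))) (blockIndex c)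

spread-injective : c ≤ 1 → 1 ≤ n → Injective _≡_ _≡_ (spread c n)
spread-injective {c} c≤1 1≤n =
  reindex-injective (λ j → blockLetter-injective (parity (c + toℕ j))) (blockIndex-onto c≤1 1≤n)

spread-disjoint : 1 ≤ n → ∀ u v → spread 0 n u ≢ spread 1 n v
spread-disjoint (s≤s _) u v eq = blockLetter-0ℙ≢1ℙ _ _ (cong (λ w → lookup w fzero) eq)

factorAt-φ : ∀ s i c n → factorAt (φ s) (i + i + c) n ≡ spread c n (factorAt s i ⌈ c + n /2⌉)
factorAt-φ s i c n = tabulate-cong λ j → begin
  φ s (i + i + c + toℕ j)
    ≡⟨ cong (φ s) (+-assoc (i + i) c (toℕ j)) ⟩
  φ s (i + i + (c + toℕ j))
    ≡⟨ φ-shift s i (c + toℕ j) ⟩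
  φ (λ k → s (i + k)) (c + toℕ j)
    ≡⟨ φ-blockLetter _ (c + toℕ j) ⟩
  blockLetter (parity (c + toℕ j)) (s (i + ⌊ c + toℕ j /2⌋))
    ≡⟨ cong (λ x → blockLetter (parity (c + toℕ j)) (s (i + x))) (toℕ-fromℕ< _) ⟨
  blockLetter (parity (c + toℕ j)) (s (i + toℕ (blockIndex c j)))
    ≡⟨ cong (blockLetter (parity (c + toℕ j))) (lookup∘tabulate _ (blockIndex c j)) ⟨
  blockLetter (parity (c + toℕ j)) (lookup (factorAt s i _) (blockIndex c j))
    ∎
  where open ≡-Reasoning

isFactor-φ⇔ : (s : Seq Bool) (w : Vec Letter n) →
              IsFactor (φ s) w ⇔ (Image (spread 0 n) (IsFactor s) w ⊎ Image (spread 1 n) (IsFactor s) w)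
isFactor-φ⇔ {n} s _ = mk⇔ to from
  where
  factorAt-φ-isImage : ∀ i c → Image (spread c n) (IsFactor s) (factorAt (φ s) (i + i + c) n)
  factorAt-φ-isImage i c =
    factorAt s i _ , Equivalence.from (isFactor⇔factorAt s _) (i , refl) , sym (factorAt-φ s i c n)

  to : ∀ {w} → IsFactor (φ s) w → Image (spread 0 n) (IsFactor s) w ⊎ Image (spread 1 n) (IsFactor s) w
  to {w} isF with Equivalence.to (isFactor⇔factorAt (φ s) w) isF
  ... | p , refl with even-or-odd p
  ...   | inj₁ (i , refl) = inj₁ (factorAt-φ-isImage i 0)
  ...   | inj₂ (i , refl) = inj₂ (factorAt-φ-isImage i 1)

  image-isFactor : ∀ c {w} → Image (spread c n) (IsFactor s) w → IsFactor (φ s) w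
  image-isFactor c (u , isF , refl) with Equivalence.to (isFactor⇔factorAt s u) isF
  ... | i , refl = Equivalence.from (isFactor⇔factorAt (φ s) _) (i + i + c , factorAt-φ s i c n)

  from : ∀ {w} → Image (spread 0 n) (IsFactor s) w ⊎ Image (spread 1 n) (IsFactor s) w → IsFactor (φ s) w
  from (inj₁ img) = image-isFactor 0 img
  from (inj₂ img) = image-isFactor 1 img

suc⌈n/2⌉+suc⌈1+n/2⌉≡n+3 : ∀ n → suc ⌈ n /2⌉ + suc ⌈ 1 + n /2⌉ ≡ n + 3
suc⌈n/2⌉+suc⌈1+n/2⌉≡n+3 n = begin
  suc ⌈ n /2⌉ + suc (suc ⌊ n /2⌋) ≡⟨ rearrange ⌈ n /2⌉ ⌊ n /2⌋ ⟩
  ⌊ n /2⌋ + ⌈ n /2⌉ + 3           ≡⟨ cong (_+ 3) (⌊n/2⌋+⌈n/2⌉≡n n) ⟩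
  n + 3                           ∎
  where
  open ≡-Reasoning
  rearrange : ∀ a b → suc a + suc (suc b) ≡ b + a + 3
  rearrange = solve-∀

proposition5p1 : (s : Seq Bool) → Sturmian s → (n : ℕ) → 1 ≤ n → HasExactlyFactors (φ s) n (n + 3)
proposition5p1 s sturmian n 1≤n =
  hasExactly-resp-⇔ (λ w → ⇔-sym (isFactor-φ⇔ s w)) (subst (HasExactly _) (suc⌈n/2⌉+suc⌈1+n/2⌉≡n+3 n)
    (hasExactly-⊎ (λ { (u , _ , refl) (v , _ , eq) → spread-disjoint 1≤n u v (sym eq) })
      (hasExactly-image (spread-injective z≤n 1≤n) (sturmian ⌈ n /2⌉ (⌈n/2⌉-mono 1≤n)))
      (hasExactly-image (spread-injective (s≤s z≤n) 1≤n) (sturmian ⌈ 1 + n /2⌉ (s≤s z≤n)))))
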